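{- For every integer $n\ge 1$, the triangular stacked prism $Y_{3,n}$ is odd prime.
   Context: All graphs are finite and simple. An odd prime labeling of a graph $G$ with $N$ vertices is a bijection $\ell:V(G)\to\{1,3,\dots,2N-1\}$ such that $\gcd(\ell(u),\ell(v))=1$ for every edge $uv$; $G$ is odd prime if it has one. For $k\ge 3$, $n\ge 1$, the stacked prism $Y_{k,n}$ is the Cartesian product $C_k\,\square\,P_n$ of the cycle on $k$ vertices with the path on $n$ vertices: its vertices are $v_{i,j}$ ($1\le i\le n$, $1\le j\le k$), with edges $v_{i,j}v_{i,j+1}$ ($1\le j\le k-1$) and $v_{i,k}v_{i,1}$ for each $i$, and $v_{i,j}v_{i+1,j}$ for $1\le i\le n-1$, $1\le j\le k$. -}

module Defs where

open import Data.Nat using (ℕ; suc; _+_; _*_; _≤_)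
open import Data.Nat.Coprimality using (Coprime)
open import Data.Fin using (Fin; toℕ; inject₁) renaming (suc to fsuc)
open import Data.Fin.Base using (fromℕ)
open import Data.Product using (_×_; _,_; Σ)
open import Data.Sum using (_⊎_)
open import Relation.Binary.PropositionalEquality using (_≡_)
open import Function.Bundles using (_⤖_; Bijection)
open import Level using (0ℓ)
open import Data.Fin.Properties using (*↔×)
open import Function.Properties.Inverse using (↔⇒⤖)
open import Function.Properties.Bijection using (⤖-isEquivalence)
open import Relation.Binary.Structures using (IsEquivalence)

record Graph : Set₁ where
  field
    V      : Set
    N      : ℕ
    enum   : V ⤖ Fin N
    Adj    : V → V → Set

odd : ℕ → ℕ
odd i = suc (2 * i)

-- An odd prime labeling: a bijection ℓ from V to {1,3,…,2N-1}, encoded as a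
-- bijection V ⤖ Fin N composed with i ↦ 2i+1, with coprime labels on every edge.
record OddPrimeLabeling (G : Graph) : Set where
  open Graph G
  field
    ℓ        : V ⤖ Fin N
    coprime  : ∀ u v → Adj u v →
               Coprime (odd (toℕ (Bijection.to ℓ u))) (odd (toℕ (Bijection.to ℓ v)))

label : {G : Graph} → OddPrimeLabeling G → Graph.V G → ℕ
label {G} L v = odd (toℕ (Bijection.to (OddPrimeLabeling.ℓ L) v))

IsOddPrime : Graph → Set
IsOddPrime G = OddPrimeLabeling G

CycleAdj : ∀ {k} → Fin k → Fin k → Set
CycleAdj {k} a b = (suc (toℕ a) ≡ toℕ b) ⊎ (suc (toℕ b) ≡ toℕ a)
                 ⊎ ((suc (toℕ a) ≡ k) × (toℕ b ≡ 0))
                 ⊎ ((suc (toℕ b) ≡ k) × (toℕ a ≡ 0))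

PathAdj : ∀ {n} → Fin n → Fin n → Set
PathAdj a b = (suc (toℕ a) ≡ toℕ b) ⊎ (suc (toℕ b) ≡ toℕ a)

-- Stacked prism Y_{k,n} = C_k □ P_n : vertex (i , j) stands for v_{i+1,j+1}.
-- Edges: same layer i and cycle-adjacent j, or same column j and path-adjacent i.
PrismAdj : ∀ k n → (Fin n × Fin k) → (Fin n × Fin k) → Set
PrismAdj k n (i , j) (i′ , j′) = ((i ≡ i′) × CycleAdj j j′) ⊎ ((j ≡ j′) × PathAdj i i′)

StackedPrism : (k n : ℕ) → Graph
StackedPrism k n = record
  { V    = Fin n × Fin k
  ; N    = n * k
  ; enum = IsEquivalence.sym ⤖-isEquivalence (↔⇒⤖ (*↔× {n} {k}))
  ; Adj  = PrismAdj k n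
  }

{-# OPTIONS --safe #-}
-- Number the 3n labels 1, 3, …, 6n−1 in consecutive triples, layer i of
-- the prism receiving the triple 6i+1, 6i+3, 6i+5 rotated cyclically by i
-- places. Then the labels at the ends of every edge differ by 2, 4 or 8:
-- inside a layer because any two of 6i+1, 6i+3, 6i+5 differ by 2 or 4, and
-- between layers because the rotation moves each label of layer i onto
-- 8 or 2 more in layer i+1. Odd numbers differing by a power of two are coprime.
module Submission where

open import Defs
open import Data.Empty using (⊥)
open import Data.Nat using (ℕ; zero; suc; _+_; _*_; _^_; _≤_)
open import Data.Nat.Divisibility using (∣-trans; ∣1⇒≡1)
open import Data.Nat.Coprimality using (Coprime; coprime-+; coprime-divisor)
  renaming (sym to coprime-sym)
open import Data.Nat.Properties using (+-assoc; +-comm; *-suc; *-distribˡ-+; 1+n≢n)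
open import Data.Fin using (Fin; toℕ; combine)
open import Data.Fin.Patterns using (0F; 1F; 2F)
open import Data.Fin.Properties using (*↔×; toℕ-combine)
open import Data.Fin.Permutation
  using (Permutation′; permutation; id; _∘ₚ_; _⟨$⟩ʳ_; _⟨$⟩ˡ_; inverseˡ; inverseʳ)
open import Data.Product using (_×_; _,_; ∃-syntax)
open import Data.Sum using (_⊎_; inj₁; inj₂; [_,_])
open import Function.Bundles using (_↔_; mk↔ₛ′; Inverse; Injection)
open import Function.Construct.Composition using (_↔-∘_)
open import Function.Construct.Symmetry using (↔-sym)
open import Function.Properties.Inverse using (↔⇒⤖; ↔⇒↣)
open import Relation.Binary.PropositionalEquality
  using (_≡_; _≢_; refl; sym; trans; cong; subst; subst₂; module ≡-Reasoning)

open ≡-Reasoning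

coprime-* : ∀ {m n o} → Coprime m n → Coprime m o → Coprime m (n * o)
coprime-* {m} {n} m⊥n m⊥o (d∣m , d∣n*o) = m⊥o (d∣m , coprime-divisor d⊥n d∣n*o)
  where
  d⊥n : Coprime _ n
  d⊥n (e∣d , e∣n) = m⊥n (∣-trans e∣d d∣m , e∣n)

coprime-^ : ∀ {m n} k → Coprime m n → Coprime m (n ^ k)
coprime-^ zero    m⊥n (_ , d∣1) = ∣1⇒≡1 d∣1
coprime-^ (suc k) m⊥n = coprime-* m⊥n (coprime-^ k m⊥n)

odd-coprime-2 : ∀ x → Coprime (odd x) 2
odd-coprime-2 zero    (d∣1 , _) = ∣1⇒≡1 d∣1
odd-coprime-2 (suc x) = subst (λ m → Coprime m 2) (cong suc (sym (*-suc 2 x)))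
  (coprime-+ (odd-coprime-2 x))

odd-+ : ∀ x c → odd (x + c) ≡ odd x + 2 * c
odd-+ x c = cong suc (*-distribˡ-+ 2 x c)

PowerOfTwoApart : ℕ → ℕ → Set
PowerOfTwoApart x y = ∃[ k ] (y ≡ x + 2 ^ k ⊎ x ≡ y + 2 ^ k)

powerOfTwoApart-sym : ∀ {x y} → PowerOfTwoApart x y → PowerOfTwoApart y x
powerOfTwoApart-sym (k , y≡x+2^k⊎x≡y+2^k) = k , [ inj₂ , inj₁ ] y≡x+2^k⊎x≡y+2^k

powerOfTwoApart-+ˡ : ∀ c {x y} → PowerOfTwoApart x y → PowerOfTwoApart (c + x) (c + y)
powerOfTwoApart-+ˡ c {x} {y} (k , inj₁ y≡x+2^k) = k , inj₁ (trans (cong (c +_) y≡x+2^k) (sym (+-assoc c x _)))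
powerOfTwoApart-+ˡ c {x} {y} (k , inj₂ x≡y+2^k) = k , inj₂ (trans (cong (c +_) x≡y+2^k) (sym (+-assoc c y _)))

odd-+-2^-coprime : ∀ x k → Coprime (odd x) (odd (x + 2 ^ k))
odd-+-2^-coprime x k = subst (Coprime (odd x)) (sym (odd-+ x (2 ^ k)))
  (coprime-sym (coprime-+ (coprime-sym (coprime-^ (suc k) (odd-coprime-2 x)))))

powerOfTwoApart⇒odd-coprime : ∀ {x y} → PowerOfTwoApart x y → Coprime (odd x) (odd y)
powerOfTwoApart⇒odd-coprime {x} (k , inj₁ refl) = odd-+-2^-coprime x k
powerOfTwoApart⇒odd-coprime {y = y} (k , inj₂ refl) = coprime-sym (odd-+-2^-coprime y k)

_^ₚ_ : ∀ {k} → Permutation′ k → ℕ → Permutation′ k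
π ^ₚ zero  = id
π ^ₚ suc t = (π ^ₚ t) ∘ₚ π

layerwise : ∀ {n k} → (Fin n → Permutation′ k) → (Fin n × Fin k) ↔ (Fin n × Fin k)
layerwise π = mk↔ₛ′
  (λ (i , j) → i , π i ⟨$⟩ʳ j)
  (λ (i , j) → i , π i ⟨$⟩ˡ j)
  (λ (i , j) → cong (i ,_) (inverseʳ (π i)))
  (λ (i , j) → cong (i ,_) (inverseˡ (π i)))

rotation : Permutation′ 3
rotation = permutation forward backward
  (λ { 0F → refl ; 1F → refl ; 2F → refl })
  (λ { 0F → refl ; 1F → refl ; 2F → refl })
  where
  forward backward : Fin 3 → Fin 3
  forward 0F = 1F
  forward 1F = 2F
  forward 2F = 0F
  backward 0F = 2F
  backward 1F = 0F
  backward 2F = 1F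

distinct⇒powerOfTwoApart : (a b : Fin 3) → a ≢ b → PowerOfTwoApart (toℕ a) (toℕ b)
distinct⇒powerOfTwoApart 0F 0F a≢b with () ← a≢b refl
distinct⇒powerOfTwoApart 0F 1F _ = 0 , inj₁ refl
distinct⇒powerOfTwoApart 0F 2F _ = 1 , inj₁ refl
distinct⇒powerOfTwoApart 1F 0F _ = 0 , inj₂ refl
distinct⇒powerOfTwoApart 1F 1F a≢b with () ← a≢b refl
distinct⇒powerOfTwoApart 1F 2F _ = 0 , inj₁ refl
distinct⇒powerOfTwoApart 2F 0F _ = 1 , inj₂ refl
distinct⇒powerOfTwoApart 2F 1F _ = 0 , inj₂ refl
distinct⇒powerOfTwoApart 2F 2F a≢b with () ← a≢b refl

rotation-powerOfTwoApart : ∀ a → PowerOfTwoApart (toℕ a) (3 + toℕ (rotation ⟨$⟩ʳ a))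
rotation-powerOfTwoApart 0F = 2 , inj₁ refl
rotation-powerOfTwoApart 1F = 2 , inj₁ refl
rotation-powerOfTwoApart 2F = 0 , inj₁ refl

cycleAdj-irrefl : ∀ {k} {a : Fin (suc (suc k))} → CycleAdj a a → ⊥
cycleAdj-irrefl (inj₁ e) = 1+n≢n e
cycleAdj-irrefl (inj₂ (inj₁ e)) = 1+n≢n e
cycleAdj-irrefl (inj₂ (inj₂ (inj₁ (e , a≡0)))) with () ← trans (cong suc (sym a≡0)) e
cycleAdj-irrefl (inj₂ (inj₂ (inj₂ (e , a≡0)))) with () ← trans (cong suc (sym a≡0)) e

layerStep-powerOfTwoApart : ∀ t j →
  PowerOfTwoApart (3 * t + toℕ ((rotation ^ₚ t) ⟨$⟩ʳ j))
                  (3 * suc t + toℕ ((rotation ^ₚ suc t) ⟨$⟩ʳ j))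
layerStep-powerOfTwoApart t j =
  subst (PowerOfTwoApart _) (shift (toℕ (rotation ⟨$⟩ʳ a)))
    (powerOfTwoApart-+ˡ (3 * t) (rotation-powerOfTwoApart a))
  where
  a : Fin 3
  a = (rotation ^ₚ t) ⟨$⟩ʳ j
  shift : ∀ c → 3 * t + (3 + c) ≡ 3 * suc t + c
  shift c = begin
    3 * t + (3 + c)  ≡⟨ +-assoc (3 * t) 3 c ⟨
    3 * t + 3 + c    ≡⟨ cong (_+ c) (+-comm (3 * t) 3) ⟩
    3 + 3 * t + c    ≡⟨ cong (_+ c) (*-suc 3 t) ⟨
    3 * suc t + c    ∎

module _ {n : ℕ} where

  twist : Fin n → Permutation′ 3
  twist i = rotation ^ₚ toℕ i

  prismLabelling : (Fin n × Fin 3) ↔ Fin (n * 3)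
  prismLabelling = ↔-sym (*↔× {n} {3}) ↔-∘ layerwise twist

  slot : Fin n × Fin 3 → ℕ
  slot (i , j) = 3 * toℕ i + toℕ (twist i ⟨$⟩ʳ j)

  toℕ-prismLabelling : ∀ u → toℕ (Inverse.to prismLabelling u) ≡ slot u
  toℕ-prismLabelling (i , j) = toℕ-combine i (twist i ⟨$⟩ʳ j)

  sameLayer-powerOfTwoApart : ∀ i {j j′} → CycleAdj j j′ → PowerOfTwoApart (slot (i , j)) (slot (i , j′))
  sameLayer-powerOfTwoApart i {j} adj = powerOfTwoApart-+ˡ (3 * toℕ i)
    (distinct⇒powerOfTwoApart _ _ λ e →
      cycleAdj-irrefl (subst (CycleAdj j) (sym (Injection.injective (↔⇒↣ (twist i)) e)) adj))

  nextLayer-powerOfTwoApart : ∀ {i i′} j → suc (toℕ i) ≡ toℕ i′ →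
                              PowerOfTwoApart (slot (i , j)) (slot (i′ , j))
  nextLayer-powerOfTwoApart {i} j 1+i≡i′ = subst
    (λ t → PowerOfTwoApart (slot (i , j)) (3 * t + toℕ ((rotation ^ₚ t) ⟨$⟩ʳ j)))
    1+i≡i′ (layerStep-powerOfTwoApart (toℕ i) j)

  prismAdj-powerOfTwoApart : ∀ {u v} → PrismAdj 3 n u v → PowerOfTwoApart (slot u) (slot v)
  prismAdj-powerOfTwoApart {i , _} (inj₁ (refl , adj))   = sameLayer-powerOfTwoApart i adj
  prismAdj-powerOfTwoApart {_ , j} (inj₂ (refl , inj₁ e)) = nextLayer-powerOfTwoApart j e
  prismAdj-powerOfTwoApart {_ , j} (inj₂ (refl , inj₂ e)) =
    powerOfTwoApart-sym (nextLayer-powerOfTwoApart j e)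

mainTheorem6 : ∀ (n : ℕ) → 1 ≤ n → IsOddPrime (StackedPrism 3 n)
mainTheorem6 n _ = record
  { ℓ       = ↔⇒⤖ prismLabelling
  ; coprime = λ u v adj → subst₂ (λ x y → Coprime (odd x) (odd y))
      (sym (toℕ-prismLabelling u)) (sym (toℕ-prismLabelling v))
      (powerOfTwoApart⇒odd-coprime (prismAdj-powerOfTwoApart adj))
  }
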